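{- Let $P$ be a forcing notion with meets, $X$ a set, and $p$ a tidy strongly $X,P$-generic condition, with witnessing function $q\mapsto q|X$ as in the definition of tidiness. Then (i) $q'|X\le q|X$ for all $q'\le q\le p$, and (ii) $q\le^* q|X$ for all $q\le p$.
   Context: $P$ has meets if any two compatible conditions $p,q$ have a greatest lower bound $p\wedge q$. A condition $p_0$ is strongly $X,P$-generic if $p_0\Vdash_P$ "$\dot G\cap X$ is a $V$-generic subset of $P\cap X$". A function $q\mapsto q|X$ (defined on $\{q\in P:q\le p_0\}$, with values in $P\cap X$) witnesses the strong $X$-genericity of $p_0$ if for every $q\le p_0$, every $r\le q|X$ with $r\in P\cap X$ is compatible with $q$. A strongly $X,P$-generic condition $p$ is tidy if there is such a witnessing function with $(q\wedge q')|X=(q|X)\wedge(q'|X)$ whenever $q,q'\le p$ are compatible. For conditions $q,r$, $q\le^* r$ means $q\Vdash r\in\dot G$. -}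

module Defs where

open import Data.Product using (Σ; ∃; _×_; _,_; proj₁)
open import Relation.Binary.PropositionalEquality using (_≡_)

record ForcingNotion : Set₁ where
  field
    Cond      : Set
    _≤_       : Cond → Cond → Set
    ≤-refl    : ∀ {p} → p ≤ p
    ≤-trans   : ∀ {p q r} → p ≤ q → q ≤ r → p ≤ r
    ≤-antisym : ∀ {p q} → p ≤ q → q ≤ p → p ≡ q

module _ (P : ForcingNotion) where
  open ForcingNotion P

  Compatible : Cond → Cond → Set
  Compatible p q = ∃ λ r → (r ≤ p) × (r ≤ q)

  IsGLB : Cond → Cond → Cond → Set
  IsGLB p q m = (m ≤ p) × (m ≤ q) × (∀ r → r ≤ p → r ≤ q → r ≤ m)

  HasMeets : Set
  HasMeets = ∀ p q → Compatible p q → Σ Cond (IsGLB p q)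

  -- q ≤* r  :  q ⊩ r ∈ Ġ, i.e. every extension of q is compatible with r
  _≤*_ : Cond → Cond → Set
  q ≤* r = ∀ s → s ≤ q → Compatible s r

  -- X is given as a predicate on conditions (P ∩ X = conditions satisfying X).
  -- f witnesses strong X,P-genericity of p.
  Witnesses : (X : Cond → Set) → Cond → (Cond → Cond) → Set
  Witnesses X p f =
    (∀ q → q ≤ p → X (f q)) ×
    (∀ q → q ≤ p → ∀ r → X r → r ≤ f q → Compatible r q)

  -- f witnesses that p is tidy: (q ∧ q')|X = (q|X) ∧ (q'|X)
  TidyWitness : HasMeets → (X : Cond → Set) → Cond → (Cond → Cond) → Set
  TidyWitness meets X p f =
    Witnesses X p f ×
    (∀ q q' → q ≤ p → q' ≤ p → (c : Compatible q q') →
       IsGLB (f q) (f q') (f (proj₁ (meets q q' c))))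

{-# OPTIONS --safe #-}
module Submission where

open import Data.Product using (_×_; _,_; proj₁; proj₂)
open import Relation.Binary.PropositionalEquality using (_≡_; subst)
open import Defs

module _ (P : ForcingNotion) where
  open ForcingNotion P

  ≤⇒compatible : ∀ {q q'} → q' ≤ q → Compatible P q q'
  ≤⇒compatible {q' = q'} q'≤q = q' , q'≤q , ≤-refl

  glb-of-≤ : ∀ {q q' m} → q' ≤ q → IsGLB P q q' m → m ≡ q'
  glb-of-≤ q'≤q (_ , m≤q' , greatest) = ≤-antisym m≤q' (greatest _ q'≤q ≤-refl)

  -- For q' ≤ q the meet q ∧ q' is q', so tidiness gives q'|X = q|X ∧ q'|X ≤ q|X.
  tidy-restriction-mono : ∀ {meets X p f} → TidyWitness P meets X p f →
    ∀ {q q'} → q' ≤ q → q ≤ p → f q' ≤ f q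
  tidy-restriction-mono {meets} {f = f} (_ , tidy) {q} {q'} q'≤q q≤p =
    subst (λ m → f m ≤ f q) (glb-of-≤ q'≤q (proj₂ (meets q q' q∥q')))
      (proj₁ (tidy q q' q≤p (≤-trans q'≤q q≤p) q∥q'))
    where
    q∥q' : Compatible P q q'
    q∥q' = ≤⇒compatible q'≤q

  -- Given s ≤ q, the condition s|X lies in X below s|X, hence is compatible with s;
  -- a common extension is then below s and below s|X ≤ q|X.
  ≤*-restriction : ∀ {X p f} → Witnesses P X p f →
    (∀ {q q'} → q' ≤ q → q ≤ p → f q' ≤ f q) →
    ∀ {q} → q ≤ p → _≤*_ P q (f q)
  ≤*-restriction {p = p} {f} (inX , compat) mono {q} q≤p s s≤q =
    let r , r≤fs , r≤s = compat s s≤p (f s) (inX s s≤p) ≤-refl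
    in r , r≤s , ≤-trans r≤fs (mono s≤q q≤p)
    where
    s≤p : s ≤ p
    s≤p = ≤-trans s≤q q≤p

proposition2p21 : (P : ForcingNotion) (meets : HasMeets P) (X : ForcingNotion.Cond P → Set)
    (p : ForcingNotion.Cond P) (f : ForcingNotion.Cond P → ForcingNotion.Cond P) →
    TidyWitness P meets X p f →
    (∀ q q' → ForcingNotion._≤_ P q' q → ForcingNotion._≤_ P q p → ForcingNotion._≤_ P (f q') (f q))
    × (∀ q → ForcingNotion._≤_ P q p → _≤*_ P q (f q))
proposition2p21 P meets X p f tidy@(witnesses , _) =
  (λ q q' → mono) , λ q → ≤*-restriction P witnesses mono
  where
  open ForcingNotion P
  mono : ∀ {q q'} → q' ≤ q → q ≤ p → f q' ≤ f q
  mono = tidy-restriction-mono P {meets} {X} tidy
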